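{- Let $\mathcal{B}$ and $\mathcal{S}$ be collections of sets in $\mathbb{R}^d$ and $q\in\mathbb{N}$, and suppose the heterochromatic $(\aleph_0,q)$-theorem for $\mathcal{B}$ with respect to $\mathcal{S}$ holds. If $\{\mathbb{F}_n\}_{n\in\mathbb{N}}$ is a sequence of subsets of $\mathcal{B}$ that has the heterochromatic $(\aleph_0,q)$-property with respect to $\mathcal{S}$, then there exist $N\in\mathbb{N}$ and a finite collection $\mathcal{K}\subset\mathcal{S}$ such that for all $n>N$ and all $C\in\mathbb{F}_n$, $\left(\bigcup_{K\in\mathcal{K}}K\right)\cap C\ne\emptyset$.
   Context: A family $\mathcal{F}\subseteq\mathcal{B}$ is finitely pierceable by $\mathcal{S}$ if there is a finite $S\subseteq\mathcal{S}$ with $\left(\bigcup_{A\in S}A\right)\cap B\ne\emptyset$ for all $B\in\mathcal{F}$. A sequence $\{B_n\}$ is a heterochromatic sequence of $\{\mathcal{F}_n\}_{n\in\mathbb{N}}$ if there is a strictly increasing sequence $\{i_n\}$ of naturals with $B_n\in\mathcal{F}_{i_n}$ for all $n$. A sequence $\{\mathcal{F}_n\}$ with $\mathcal{F}_n\subseteq\mathcal{B}$ has the heterochromatic $(\aleph_0,q)$-property with respect to $\mathcal{S}$ if for every heterochromatic sequence $\{B_n\}$ of $\{\mathcal{F}_n\}$ there is $A\in\mathcal{S}$ meeting $q$ distinct $B_n$'s. The heterochromatic $(\aleph_0,q)$-theorem for $\mathcal{B}$ with respect to $\mathcal{S}$ holds if for every sequence $\{\mathcal{F}_n\}$ of subsets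 of $\mathcal{B}$ with the heterochromatic $(\aleph_0,q)$-property with respect to $\mathcal{S}$ there is some $n$ with $\mathcal{F}_n$ finitely pierceable by $\mathcal{S}$. -}

module Defs where

open import Data.Nat using (ℕ; suc; _<_)
open import Data.Fin using (Fin)
open import Data.Product using (Σ; ∃; _×_; _,_)
open import Function.Definitions using (Injective)
open import Relation.Binary.PropositionalEquality using (_≡_)

SubsetOf : Set → Set₁
SubsetOf X = X → Set

Collection : Set → Set₁
Collection X = SubsetOf X → Set

module _ {X : Set} where

  _⊆ᶜ_ : Collection X → Collection X → Set₁
  𝓕 ⊆ᶜ 𝓑 = ∀ C → 𝓕 C → 𝓑 C

  Meets : SubsetOf X → SubsetOf X → Set
  Meets A C = ∃ λ x → A x × C x

  ⋃ : {k : ℕ} → (Fin k → SubsetOf X) → SubsetOf X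
  ⋃ {k} K x = Σ (Fin k) λ i → K i x

  -- 𝓕 is finitely pierceable by 𝓢: there is a finite S ⊆ 𝓢
  -- (given as a family K₀,…,K_{k-1} of members of 𝓢) such that
  -- (⋃ S) ∩ B ≠ ∅ for every B ∈ 𝓕.
  FinitelyPierceable : Collection X → Collection X → Set₁
  FinitelyPierceable 𝓢 𝓕 =
    Σ ℕ λ k → Σ (Fin k → SubsetOf X) λ K →
      (∀ i → 𝓢 (K i)) × (∀ B → 𝓕 B → Meets (⋃ K) B)

  StrictlyIncreasing : (ℕ → ℕ) → Set
  StrictlyIncreasing i = ∀ m n → m < n → i m < i n

  Heterochromatic : (ℕ → Collection X) → (ℕ → SubsetOf X) → Set
  Heterochromatic 𝓕 B =
    Σ (ℕ → ℕ) λ i → StrictlyIncreasing i × (∀ n → 𝓕 (i n) (B n))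

  -- heterochromatic (ℵ₀,q)-property of {𝓕ₙ} w.r.t. 𝓢: for every
  -- heterochromatic sequence {Bₙ} some A ∈ 𝓢 meets q distinct Bₙ's
  -- (q members with pairwise distinct indices).
  HetProperty : ℕ → Collection X → (ℕ → Collection X) → Set₁
  HetProperty q 𝓢 𝓕 =
    ∀ (B : ℕ → SubsetOf X) → Heterochromatic 𝓕 B →
      Σ (SubsetOf X) λ A → 𝓢 A ×
        Σ (Fin q → ℕ) λ idx → Injective _≡_ _≡_ idx ×
          (∀ j → Meets A (B (idx j)))

  HetTheorem : ℕ → Collection X → Collection X → Set₁
  HetTheorem q 𝓑 𝓢 =
    ∀ (𝓕 : ℕ → Collection X) → (∀ n → 𝓕 n ⊆ᶜ 𝓑) →
      HetProperty q 𝓢 𝓕 → Σ ℕ λ n → FinitelyPierceable 𝓢 (𝓕 n)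

{-# OPTIONS --safe #-}
-- Apply the heterochromatic theorem to the tails Tₙ := ⋃_{m > n} 𝔽ₘ. A
-- heterochromatic sequence of the tails has a subsequence which is
-- heterochromatic for {𝔽ₙ} itself (each chosen member lies in a family of
-- larger index than the last), so {Tₙ} inherits the (ℵ₀,q)-property. A finite
-- piercing of one tail Tₙ pierces every 𝔽ₘ with m > n.
module Submission where

open import Defs
open import Data.Nat using (ℕ; zero; suc; _<_; _≤_; z≤n; s≤s)
open import Data.Nat.Properties
  using (<-trans; ≤-<-trans; <-irrefl; <-cmp; n<1+n; m<1+n⇒m<n∨m≡n)
open import Data.Fin using (Fin)
open import Data.Product using (Σ; ∃; _×_; _,_)
open import Data.Sum using (inj₁; inj₂)
open import Data.Empty using (⊥-elim)
open import Function using (_∘_)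
open import Function.Definitions using (Injective)
open import Relation.Binary using (tri<; tri≈; tri>)
open import Relation.Binary.PropositionalEquality using (_≡_; refl; sym)

-- The ambient-space parameter of StrictlyIncreasing is unused, so any choice
-- of it (here ℕ) unfolds to the same type.
module _ {f : ℕ → ℕ} where

  strictlyIncreasing-step : (∀ n → f n < f (suc n)) → StrictlyIncreasing {ℕ} f
  strictlyIncreasing-step f<f∘suc m (suc n) m<1+n with m<1+n⇒m<n∨m≡n m<1+n
  ... | inj₁ m<n  = <-trans (strictlyIncreasing-step f<f∘suc m n m<n) (f<f∘suc n)
  ... | inj₂ refl = f<f∘suc m

  strictlyIncreasing⇒≤ : StrictlyIncreasing {ℕ} f → ∀ n → n ≤ f n
  strictlyIncreasing⇒≤ f-inc zero    = z≤n
  strictlyIncreasing⇒≤ f-inc (suc n) =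
    ≤-<-trans (strictlyIncreasing⇒≤ f-inc n) (f-inc n (suc n) (n<1+n n))

  strictlyIncreasing⇒injective : StrictlyIncreasing {ℕ} f → Injective _≡_ _≡_ f
  strictlyIncreasing⇒injective f-inc {m} {n} fm≡fn with <-cmp m n
  ... | tri< m<n _ _ = ⊥-elim (<-irrefl fm≡fn (f-inc m n m<n))
  ... | tri≈ _ m≡n _ = m≡n
  ... | tri> _ _ n<m = ⊥-elim (<-irrefl (sym fm≡fn) (f-inc n m n<m))

module _ {X : Set} where

  Tail : (ℕ → Collection X) → ℕ → Collection X
  Tail 𝔽 n C = ∃ λ m → n < m × 𝔽 m C

  Tail-⊆ᶜ : ∀ {𝓑 𝔽} → (∀ n → 𝔽 n ⊆ᶜ 𝓑) → ∀ n → Tail 𝔽 n ⊆ᶜ 𝓑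
  Tail-⊆ᶜ 𝔽⊆𝓑 n C (m , _ , C∈𝔽m) = 𝔽⊆𝓑 m C C∈𝔽m

  Tail-pierce : ∀ {𝓢 𝔽} n → FinitelyPierceable 𝓢 (Tail 𝔽 n) →
    Σ ℕ λ k → Σ (Fin k → SubsetOf X) λ 𝓚 → (∀ i → 𝓢 (𝓚 i)) ×
      (∀ m → n < m → ∀ C → 𝔽 m C → Meets (⋃ 𝓚) C)
  Tail-pierce n (k , 𝓚 , 𝓚⊆𝓢 , pierce) =
    k , 𝓚 , 𝓚⊆𝓢 , λ m n<m C C∈𝔽m → pierce C (m , n<m , C∈𝔽m)

  heterochromatic-Tail⇒subsequence : ∀ {𝔽 B} → Heterochromatic (Tail 𝔽) B →
    Σ (ℕ → ℕ) λ s → StrictlyIncreasing {ℕ} s × Heterochromatic 𝔽 (B ∘ s)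
  heterochromatic-Tail⇒subsequence {𝔽} {B} (i , i-inc , B∈Tail) =
    s , s-inc , s ∘ suc , (λ m n → s-inc (suc m) (suc n) ∘ s≤s) , B∘s∈𝔽
    where
    next : ℕ → ℕ
    next n with B∈Tail n
    ... | m , _ = m

    n<next : ∀ n → n < next n
    n<next n with B∈Tail n
    ... | _ , i<m , _ = ≤-<-trans (strictlyIncreasing⇒≤ i-inc n) i<m

    B∈𝔽next : ∀ n → 𝔽 (next n) (B n)
    B∈𝔽next n with B∈Tail n
    ... | _ , _ , B∈𝔽m = B∈𝔽m

    -- Each index of the subsequence is the family index of the previous member.
    s : ℕ → ℕ
    s zero    = zero
    s (suc k) = next (s k)

    s-inc : StrictlyIncreasing {ℕ} s
    s-inc = strictlyIncreasing-step (n<next ∘ s)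

    B∘s∈𝔽 : ∀ k → 𝔽 (s (suc k)) (B (s k))
    B∘s∈𝔽 k = B∈𝔽next (s k)

  hetProperty-Tail : ∀ {q 𝓢 𝔽} → HetProperty q 𝓢 𝔽 → HetProperty q 𝓢 (Tail 𝔽)
  hetProperty-Tail {𝔽 = 𝔽} hp B B-het
    with heterochromatic-Tail⇒subsequence {𝔽 = 𝔽} B-het
  ... | s , s-inc , B∘s-het with hp (B ∘ s) B∘s-het
  ...   | A , A∈𝓢 , idx , idx-inj , A-meets =
    A , A∈𝓢 , s ∘ idx , idx-inj ∘ strictlyIncreasing⇒injective s-inc , A-meets

lemma2 : (X : Set) (𝓑 𝓢 : Collection X) (q : ℕ) →
    HetTheorem q 𝓑 𝓢 →
    (𝔽 : ℕ → Collection X) → (∀ n → 𝔽 n ⊆ᶜ 𝓑) →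
    HetProperty q 𝓢 𝔽 →
    Σ ℕ λ N → Σ ℕ λ k → Σ (Fin k → SubsetOf X) λ 𝓚 →
      (∀ i → 𝓢 (𝓚 i)) ×
      (∀ n → N < n → ∀ C → 𝔽 n C → Meets (⋃ 𝓚) C)
lemma2 X 𝓑 𝓢 q het-theorem 𝔽 𝔽⊆𝓑 hp
  with het-theorem (Tail 𝔽) (Tail-⊆ᶜ 𝔽⊆𝓑) (hetProperty-Tail {𝔽 = 𝔽} hp)
... | N , Tail-N-pierceable = N , Tail-pierce {𝓢 = 𝓢} {𝔽 = 𝔽} N Tail-N-pierceable
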